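{- The modal logic $\Gamma(\mathbf{LV},2,1)$ has the uniform Lyndon interpolation property.
   Context: Modal formulas use variables, $\bot,\land,\lor,\neg,\to,\Box$. Positive/negative variables: $v^+(p)=\{p\}$, $v^-(p)=\emptyset$, $v^\circ(\bot)=\emptyset$, $\land,\lor,\Box$ preserve polarity, $v^\pm(\neg\varphi)=v^\mp(\varphi)$, $v^+(\varphi\to\psi)=v^-(\varphi)\cup v^+(\psi)$, $v^-(\varphi\to\psi)=v^+(\varphi)\cup v^-(\psi)$. $\Gamma(\mathbf{LV},2,1)$ is the set of modal formulas true at every world of every Kripke model on the frame $(W,R)$ with $W=\{r,a_0,b_0,a_1,b_1\}$ and $R$ the reflexive transitive closure of $\{(r,a_0),(r,b_0),(r,a_1),(r,b_1),(a_0,b_0),(b_0,a_0),(a_1,b_1),(b_1,a_1)\}$ (a root below two distinct two-element final clusters). A logic $L$ has the uniform Lyndon interpolation property iff for every formula $\varphi$ and finite sets $P^+,P^-$ of variables there is $\theta$ with $L\vdash\varphi\to\theta$, $v^\circ(\theta)\subseteq v^\circ(\varphi)\setminus P^\circ$ for $\circ\in\{+,-\}$, and $L\vdash\theta\to\psi$ for every $\psi$ with $L\vdash\varphi\to\psi$ and $v^\circ(\psi)\cap P^\circ=\emptyset$ for $\circ\in\{+,-\}$. -}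

module Defs where

open import Data.Nat using (ℕ)
open import Data.Bool using (Bool; true)
open import Data.List using (List; []; [_]; _++_)
open import Data.List.Membership.Propositional using (_∈_; _∉_)
open import Data.Product using (_×_; Σ)
open import Data.Empty using (⊥)
open import Data.Sum using (_⊎_)
open import Data.Unit using (⊤)
open import Relation.Binary.PropositionalEquality using (_≡_)
open import Relation.Binary.Construct.Closure.ReflexiveTransitive using (Star)

infixr 4 _⇒_
infixr 5 _∨_
infixr 6 _∧_
data Fm : Set where
  var  : ℕ → Fm
  ⊥'   : Fm
  _∧_  : Fm → Fm → Fm
  _∨_  : Fm → Fm → Fm
  ¬'   : Fm → Fm
  _⇒_  : Fm → Fm → Fm
  □    : Fm → Fm

mutual
  v⁺ : Fm → List ℕ
  v⁺ (var p)   = [ p ]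
  v⁺ ⊥'        = []
  v⁺ (φ ∧ ψ)   = v⁺ φ ++ v⁺ ψ
  v⁺ (φ ∨ ψ)   = v⁺ φ ++ v⁺ ψ
  v⁺ (¬' φ)    = v⁻ φ
  v⁺ (φ ⇒ ψ)   = v⁻ φ ++ v⁺ ψ
  v⁺ (□ φ)     = v⁺ φ

  v⁻ : Fm → List ℕ
  v⁻ (var p)   = []
  v⁻ ⊥'        = []
  v⁻ (φ ∧ ψ)   = v⁻ φ ++ v⁻ ψ
  v⁻ (φ ∨ ψ)   = v⁻ φ ++ v⁻ ψ
  v⁻ (¬' φ)    = v⁺ φ
  v⁻ (φ ⇒ ψ)   = v⁺ φ ++ v⁻ ψ
  v⁻ (□ φ)     = v⁻ φ

-- The frame of LV(2,1): a root r below two distinct two-element final clusters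
data W : Set where
  r a₀ b₀ a₁ b₁ : W

data Edge : W → W → Set where
  r-a₀  : Edge r a₀
  r-b₀  : Edge r b₀
  r-a₁  : Edge r a₁
  r-b₁  : Edge r b₁
  a₀-b₀ : Edge a₀ b₀
  b₀-a₀ : Edge b₀ a₀
  a₁-b₁ : Edge a₁ b₁
  b₁-a₁ : Edge b₁ a₁

R : W → W → Set
R = Star Edge

Valuation : Set
Valuation = ℕ → W → Bool

_,_⊨_ : Valuation → W → Fm → Set
V , w ⊨ var p   = V p w ≡ true
V , w ⊨ ⊥'      = ⊥
V , w ⊨ (φ ∧ ψ) = (V , w ⊨ φ) × (V , w ⊨ ψ)
V , w ⊨ (φ ∨ ψ) = (V , w ⊨ φ) ⊎ (V , w ⊨ ψ)
V , w ⊨ ¬' φ    = (V , w ⊨ φ) → ⊥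
V , w ⊨ (φ ⇒ ψ) = (V , w ⊨ φ) → (V , w ⊨ ψ)
V , w ⊨ □ φ     = ∀ u → R w u → V , u ⊨ φ

⊢Γ : Fm → Set
⊢Γ φ = ∀ (V : Valuation) (w : W) → V , w ⊨ φ

ULIP : Set
ULIP = ∀ (φ : Fm) (P⁺ P⁻ : List ℕ) → Σ Fm λ θ →
    ⊢Γ (φ ⇒ θ)
  × (∀ p → p ∈ v⁺ θ → p ∈ v⁺ φ × p ∉ P⁺)
  × (∀ p → p ∈ v⁻ θ → p ∈ v⁻ φ × p ∉ P⁻)
  × (∀ ψ → ⊢Γ (φ ⇒ ψ)
         → (∀ p → p ∈ v⁺ ψ → p ∉ P⁺)
         → (∀ p → p ∈ v⁻ ψ → p ∉ P⁻)
         → ⊢Γ (θ ⇒ ψ))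

-- Fix φ, P⁺ and P⁻, and call a literal allowed if it is a variable occurring positively in φ
-- and not in P⁺, or the negation of a variable occurring negatively in φ and not in P⁻. For a
-- valuation V* let literals y be the conjunction of the allowed literals true at y. Because the
-- frame has only five points, there is a formula characteristic u* whose truth at (V, u) yields
-- p-morphisms k, h from the frame to itself with k r = u*, h r = u and literals (k y) true at
-- h y for every y: a directed bisimulation through which exactly the allowed literals pass.
-- θ is the disjunction of characteristic u* over the pointed models (V*, u*) of φ, which is
-- finite because only the values of V* on the variables of φ matter, and each model of φ
-- satisfies its own disjunct. Conversely, φ holds at r under V* ∘ k; a valuation agreeing with
-- V* ∘ k on the forbidden variables and pushed towards V ∘ h elsewhere still satisfies φ by
-- polarity, hence satisfies ψ, and as ψ avoids the forbidden literals it survives the remaining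
-- move to V ∘ h, so ψ holds at h r = u.

module Submission where

open import Data.Bool using (Bool; true; false; if_then_else_)
import Data.Bool as Bool
open import Data.Bool.Properties using (∧-conicalˡ; ∧-conicalʳ; not-¬; ¬-not)
open import Data.Empty using (⊥-elim)
open import Data.Fin using (Fin; zero; suc)
import Data.Fin.Properties as Fin
open import Data.List using (List; []; _∷_; [_]; _++_; filter; cartesianProduct; cartesianProductWith; map; allFin)
open import Data.List.Membership.Propositional using (_∈_; _∉_)
open import Data.List.Membership.Propositional.Properties
  using (∈-++⁺ˡ; ∈-++⁺ʳ; ∈-++⁻; ∈-filter⁺; ∈-filter⁻; ∈-cartesianProductWith⁺; ∈-cartesianProduct⁺; ∈-map⁺; ∈-allFin)
open import Data.List.Relation.Binary.Subset.Propositional using (_⊆_)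
open import Data.List.Relation.Binary.Subset.Propositional.Properties using (xs⊆xs++ys; xs⊆ys++xs; ++⁺)
open import Data.List.Relation.Unary.Any using (here; there)
open import Data.Nat using (ℕ)
open import Data.Nat.Properties using () renaming (_≟_ to _≟ℕ_)
open import Data.List.Membership.DecPropositional _≟ℕ_ using (_∈?_; _∉?_)
open import Data.Product using (_×_; _,_; proj₁; proj₂; ∃-syntax)
import Data.Product as Product
open import Data.Product.Properties using (≡-dec)
open import Data.Sum using (_⊎_; inj₁; inj₂; [_,_]′; swap)
import Data.Sum as Sum
open import Function using (_∘_; const; case_of_)
open import Relation.Binary.Definitions using (DecidableEquality)
open import Relation.Binary.PropositionalEquality using (_≡_; _≢_; refl; cong; subst; sym; trans)
open import Relation.Binary.Construct.Closure.ReflexiveTransitive using (ε; _◅_; _◅◅_)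
open import Relation.Nullary using (Dec; yes; no; ¬?; does)
open import Relation.Nullary.Decidable using (map′; from-yes; decidable-stable; _×-dec_; _⊎-dec_; _→-dec_)
open import Relation.Unary using (Decidable)

open import Defs

toFin : W → Fin 5
toFin r  = zero
toFin a₀ = suc zero
toFin b₀ = suc (suc zero)
toFin a₁ = suc (suc (suc zero))
toFin b₁ = suc (suc (suc (suc zero)))

fromFin : Fin 5 → W
fromFin zero                         = r
fromFin (suc zero)                   = a₀
fromFin (suc (suc zero))             = b₀
fromFin (suc (suc (suc zero)))       = a₁
fromFin (suc (suc (suc (suc zero)))) = b₁

fromFin-toFin : ∀ w → fromFin (toFin w) ≡ w
fromFin-toFin r  = refl
fromFin-toFin a₀ = refl
fromFin-toFin b₀ = refl
fromFin-toFin a₁ = refl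
fromFin-toFin b₁ = refl

_≟_ : DecidableEquality W
w ≟ w′ = map′ injective (cong toFin) (toFin w Fin.≟ toFin w′)
  where
  injective : toFin w ≡ toFin w′ → w ≡ w′
  injective e = trans (sym (fromFin-toFin w)) (trans (cong fromFin e) (fromFin-toFin w′))

∀? : ∀ {P : W → Set} → Decidable P → Dec (∀ w → P w)
∀? {P} P? = map′ (λ ∀i w → subst P (fromFin-toFin w) (∀i (toFin w))) (λ ∀w → ∀w ∘ fromFin)
                 (Fin.all? (P? ∘ fromFin))

∃? : ∀ {P : W → Set} → Decidable P → Dec (∃[ w ] P w)
∃? {P} P? = map′ (λ (i , p) → fromFin i , p) (λ (w , p) → toFin w , subst P (sym (fromFin-toFin w)) p)
                 (Fin.any? (P? ∘ fromFin))

allW : List W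
allW = map fromFin (allFin 5)

∈-allW : ∀ w → w ∈ allW
∈-allW w = subst (_∈ allW) (fromFin-toFin w) (∈-map⁺ fromFin (∈-allFin (toFin w)))

-- partner r = r is a junk value; it makes R-partner and partner-involutive hold everywhere.
partner : W → W
partner r  = r
partner a₀ = b₀
partner b₀ = a₀
partner a₁ = b₁
partner b₁ = a₁

partner-involutive : ∀ w → partner (partner w) ≡ w
partner-involutive r  = refl
partner-involutive a₀ = refl
partner-involutive b₀ = refl
partner-involutive a₁ = refl
partner-involutive b₁ = refl

R-root : ∀ w → R r w
R-root r  = ε
R-root a₀ = r-a₀ ◅ ε
R-root b₀ = r-b₀ ◅ ε
R-root a₁ = r-a₁ ◅ ε
R-root b₁ = r-b₁ ◅ ε

R-partner : ∀ w → R w (partner w)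
R-partner r  = ε
R-partner a₀ = a₀-b₀ ◅ ε
R-partner b₀ = b₀-a₀ ◅ ε
R-partner a₁ = a₁-b₁ ◅ ε
R-partner b₁ = b₁-a₁ ◅ ε

final-successor : ∀ {c z} → c ≢ r → R c z → z ≡ c ⊎ z ≡ partner c
final-successor {r} c≢r _     = ⊥-elim (c≢r refl)
final-successor _ ε           = inj₁ refl
final-successor _ (a₀-b₀ ◅ s) = swap (final-successor (λ ()) s)
final-successor _ (b₀-a₀ ◅ s) = swap (final-successor (λ ()) s)
final-successor _ (a₁-b₁ ◅ s) = swap (final-successor (λ ()) s)
final-successor _ (b₁-a₁ ◅ s) = swap (final-successor (λ ()) s)

R? : ∀ x y → Dec (R x y)
R? x y with x ≟ r
... | yes refl = yes (R-root y)
... | no x≢r   = map′ in-cluster (final-successor x≢r) (y ≟ x ⊎-dec y ≟ partner x)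
  where
  in-cluster : y ≡ x ⊎ y ≡ partner x → R x y
  in-cluster (inj₁ refl) = ε
  in-cluster (inj₂ refl) = R-partner x

record IsPMorphism (f : W → W) : Set where
  field
    forth : ∀ {x y} → R x y → R (f x) (f y)
    back  : ∀ {x z} → R (f x) z → ∃[ y ] R x y × f y ≡ z

IsPMorphism? : ∀ f → Dec (IsPMorphism f)
IsPMorphism? f =
  map′ (λ (forth , back) → record { forth = forth _ _ ; back = back _ _ })
       (λ pm → (λ _ _ → IsPMorphism.forth pm) , (λ _ _ → IsPMorphism.back pm))
       (    ∀? (λ x → ∀? λ y → R? x y →-dec R? (f x) (f y))
      ×-dec ∀? (λ x → ∀? λ z → R? (f x) z →-dec ∃? λ y → R? x y ×-dec f y ≟ z))

clusterMap : W → W → W → W → W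
clusterMap ρ x₀ x₁ r  = ρ
clusterMap ρ x₀ x₁ a₀ = x₀
clusterMap ρ x₀ x₁ b₀ = partner x₀
clusterMap ρ x₀ x₁ a₁ = x₁
clusterMap ρ x₀ x₁ b₁ = partner x₁

final-cluster : ∀ {c z y} → c ≢ r → R c z → R c y → R z y
final-cluster {c} {z} {y} =
  from-yes (∀? λ c → ∀? λ z → ∀? λ y → ¬? (c ≟ r) →-dec R? c z →-dec R? c y →-dec R? z y) c z y

sees-a₀-or-a₁ : ∀ w → R w a₀ ⊎ R w a₁
sees-a₀-or-a₁ w = from-yes (∀? λ w → R? w a₀ ⊎-dec R? w a₁) w

clusterMap-pm-final : ∀ {c x₀ x₁} → c ≢ r → R c x₀ → R c x₁ → IsPMorphism (clusterMap c x₀ x₁)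
clusterMap-pm-final {c} {x₀} {x₁} =
  from-yes (∀? λ c → ∀? λ x₀ → ∀? λ x₁ →
              ¬? (c ≟ r) →-dec R? c x₀ →-dec R? c x₁ →-dec IsPMorphism? (clusterMap c x₀ x₁)) c x₀ x₁

clusterMap-pm-root : ∀ {x₀ x₁} → R a₀ x₀ → R a₁ x₁
                   → IsPMorphism (clusterMap r x₀ x₁) × IsPMorphism (clusterMap r x₁ x₀)
clusterMap-pm-root {x₀} {x₁} =
  from-yes (∀? λ x₀ → ∀? λ x₁ → R? a₀ x₀ →-dec R? a₁ x₁ →-dec
              IsPMorphism? (clusterMap r x₀ x₁) ×-dec IsPMorphism? (clusterMap r x₁ x₀)) x₀ x₁

⊤' : Fm
⊤' = ¬' ⊥'

◇ : Fm → Fm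
◇ χ = ¬' (□ (¬' χ))

⊨? : ∀ V w χ → Dec (V , w ⊨ χ)
⊨? V w (var p)  = V p w Bool.≟ true
⊨? V w ⊥'       = no λ ()
⊨? V w (χ ∧ χ′) = ⊨? V w χ ×-dec ⊨? V w χ′
⊨? V w (χ ∨ χ′) = ⊨? V w χ ⊎-dec ⊨? V w χ′
⊨? V w (¬' χ)   = ¬? (⊨? V w χ)
⊨? V w (χ ⇒ χ′) = ⊨? V w χ →-dec ⊨? V w χ′
⊨? V w (□ χ)    = ∀? λ u → R? w u →-dec ⊨? V u χ

◇-intro : ∀ {V w u} χ → R w u → V , u ⊨ χ → V , w ⊨ ◇ χ
◇-intro χ e x h = h _ e x

-- Truth is decidable on the finite frame, so ◇ = ¬□¬ yields a witness constructively.
◇-elim : ∀ {V w} χ → V , w ⊨ ◇ χ → ∃[ u ] R w u × V , u ⊨ χ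
◇-elim {V} {w} χ h with ∃? (λ u → R? w u ×-dec ⊨? V u χ)
... | yes found = found
... | no none = ⊥-elim (h λ u e x → none (u , e , x))

◇-locate : ∀ {V u} χ → u ≢ r → V , u ⊨ ◇ χ → V , u ⊨ χ ⊎ V , partner u ⊨ χ
◇-locate χ u≢r h with ◇-elim χ h
... | z , e , x with final-successor u≢r e
...   | inj₁ refl = inj₁ x
...   | inj₂ refl = inj₂ x

□-up : ∀ {P : W → Set} {z y} → R z y → (∀ u → R z u → P u) → (∀ u → R y u → P u)
□-up e h u e′ = h u (e ◅◅ e′)

_≤⟨_⟩_ : Valuation → List ℕ → Valuation → Set
V₁ ≤⟨ qs ⟩ V₂ = ∀ {q} → q ∈ qs → ∀ y → V₁ q y ≡ true → V₂ q y ≡ true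

≤-⊆ : ∀ {V₁ V₂ xs ys} → xs ⊆ ys → V₁ ≤⟨ ys ⟩ V₂ → V₁ ≤⟨ xs ⟩ V₂
≤-⊆ xs⊆ys h q∈ = h (xs⊆ys q∈)

⊨-monotone : ∀ χ {V₁ V₂ w} → V₁ ≤⟨ v⁺ χ ⟩ V₂ → V₂ ≤⟨ v⁻ χ ⟩ V₁ → V₁ , w ⊨ χ → V₂ , w ⊨ χ
⊨-monotone (var p)  h⁺ h⁻ = h⁺ (here refl) _
⊨-monotone ⊥'       h⁺ h⁻ = λ ()
⊨-monotone (χ ∧ χ′) h⁺ h⁻ = Product.map (⊨-monotone χ (≤-⊆ (xs⊆xs++ys _ _) h⁺) (≤-⊆ (xs⊆xs++ys _ _) h⁻))
                                        (⊨-monotone χ′ (≤-⊆ (xs⊆ys++xs _ _) h⁺) (≤-⊆ (xs⊆ys++xs _ _) h⁻))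
⊨-monotone (χ ∨ χ′) h⁺ h⁻ = Sum.map (⊨-monotone χ (≤-⊆ (xs⊆xs++ys _ _) h⁺) (≤-⊆ (xs⊆xs++ys _ _) h⁻))
                                    (⊨-monotone χ′ (≤-⊆ (xs⊆ys++xs _ _) h⁺) (≤-⊆ (xs⊆ys++xs _ _) h⁻))
⊨-monotone (¬' χ)   h⁺ h⁻ = λ n → n ∘ ⊨-monotone χ h⁻ h⁺
⊨-monotone (χ ⇒ χ′) h⁺ h⁻ = λ g → ⊨-monotone χ′ (≤-⊆ (xs⊆ys++xs _ _) h⁺) (≤-⊆ (xs⊆ys++xs _ _) h⁻)
                                  ∘ g ∘ ⊨-monotone χ (≤-⊆ (xs⊆xs++ys _ _) h⁻) (≤-⊆ (xs⊆xs++ys _ _) h⁺)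
⊨-monotone (□ χ)    h⁺ h⁻ = λ g u e → ⊨-monotone χ h⁺ h⁻ (g u e)

Agree : List ℕ → Valuation → Valuation → Set
Agree qs V₁ V₂ = ∀ {q} → q ∈ qs → ∀ y → V₁ q y ≡ V₂ q y

⊨-agree : ∀ χ {V₁ V₂ w} → Agree (v⁺ χ ++ v⁻ χ) V₁ V₂ → V₁ , w ⊨ χ → V₂ , w ⊨ χ
⊨-agree χ agree = ⊨-monotone χ (λ q∈ y → trans (sym (agree (∈-++⁺ˡ q∈) y)))
                               (λ q∈ y → trans (agree (∈-++⁺ʳ (v⁺ χ) q∈) y))

infixl 25 _∘ᵥ_
_∘ᵥ_ : Valuation → (W → W) → Valuation
(V ∘ᵥ f) q y = V q (f y)

module _ {f : W → W} (pm : IsPMorphism f) where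
  open IsPMorphism pm

  pullback⁺ : ∀ χ {V y} → V , f y ⊨ χ → V ∘ᵥ f , y ⊨ χ
  pullback⁻ : ∀ χ {V y} → V ∘ᵥ f , y ⊨ χ → V , f y ⊨ χ

  pullback⁺ (var p)  = λ x → x
  pullback⁺ ⊥'       = λ x → x
  pullback⁺ (χ ∧ χ′) = Product.map (pullback⁺ χ) (pullback⁺ χ′)
  pullback⁺ (χ ∨ χ′) = Sum.map (pullback⁺ χ) (pullback⁺ χ′)
  pullback⁺ (¬' χ)   = λ n → n ∘ pullback⁻ χ
  pullback⁺ (χ ⇒ χ′) = λ g → pullback⁺ χ′ ∘ g ∘ pullback⁻ χ
  pullback⁺ (□ χ)    = λ g y e → pullback⁺ χ (g _ (forth e))

  pullback⁻ (var p)  = λ x → x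
  pullback⁻ ⊥'       = λ x → x
  pullback⁻ (χ ∧ χ′) = Product.map (pullback⁻ χ) (pullback⁻ χ′)
  pullback⁻ (χ ∨ χ′) = Sum.map (pullback⁻ χ) (pullback⁻ χ′)
  pullback⁻ (¬' χ)   = λ n → n ∘ pullback⁺ χ
  pullback⁻ (χ ⇒ χ′) = λ g → pullback⁻ χ′ ∘ g ∘ pullback⁺ χ
  pullback⁻ (□ χ)    = λ g z e → case back e of λ { (y , e′ , refl) → pullback⁻ χ (g y e′) }

⋁ ⋀ : {A : Set} → List A → (A → Fm) → Fm
⋁ []       F = ⊥'
⋁ (x ∷ xs) F = F x ∨ ⋁ xs F
⋀ []       F = ⊤'
⋀ (x ∷ xs) F = F x ∧ ⋀ xs F

module _ {A : Set} {F : A → Fm} {V : Valuation} {w : W} where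

  ⋁-intro : ∀ {x xs} → x ∈ xs → V , w ⊨ F x → V , w ⊨ ⋁ xs F
  ⋁-intro (here refl) h = inj₁ h
  ⋁-intro (there x∈)  h = inj₂ (⋁-intro x∈ h)

  ⋁-elim : ∀ xs → V , w ⊨ ⋁ xs F → ∃[ x ] x ∈ xs × V , w ⊨ F x
  ⋁-elim (x ∷ xs) (inj₁ h) = x , here refl , h
  ⋁-elim (x ∷ xs) (inj₂ h) = let (y , y∈ , h′) = ⋁-elim xs h in y , there y∈ , h′

  ⋀-intro : ∀ xs → (∀ {x} → x ∈ xs → V , w ⊨ F x) → V , w ⊨ ⋀ xs F
  ⋀-intro []       h = λ ()
  ⋀-intro (x ∷ xs) h = h (here refl) , ⋀-intro xs (h ∘ there)

  ⋀-elim : ∀ {x xs} → V , w ⊨ ⋀ xs F → x ∈ xs → V , w ⊨ F x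
  ⋀-elim (h , _) (here refl) = h
  ⋀-elim (_ , h) (there x∈)  = ⋀-elim h x∈

record InSig (Pos Neg : List ℕ) (χ : Fm) : Set where
  constructor sig
  field
    pos : v⁺ χ ⊆ Pos
    neg : v⁻ χ ⊆ Neg

⊆-++ : ∀ {xs ys zs : List ℕ} → xs ⊆ zs → ys ⊆ zs → xs ++ ys ⊆ zs
⊆-++ {xs} xs⊆ ys⊆ q∈ = [ xs⊆ , ys⊆ ]′ (∈-++⁻ xs q∈)

module _ {Pos Neg : List ℕ} where

  sig-var : ∀ {q} → q ∈ Pos → InSig Pos Neg (var q)
  sig-var q∈ = sig (λ { (here refl) → q∈ }) λ ()

  sig-¬var : ∀ {q} → q ∈ Neg → InSig Pos Neg (¬' (var q))
  sig-¬var q∈ = sig (λ ()) λ { (here refl) → q∈ }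

  sig-⊤ : InSig Pos Neg ⊤'
  sig-⊤ = sig (λ ()) λ ()

  sig-∧ : ∀ {χ χ′} → InSig Pos Neg χ → InSig Pos Neg χ′ → InSig Pos Neg (χ ∧ χ′)
  sig-∧ (sig p n) (sig p′ n′) = sig (⊆-++ p p′) (⊆-++ n n′)

  sig-∨ : ∀ {χ χ′} → InSig Pos Neg χ → InSig Pos Neg χ′ → InSig Pos Neg (χ ∨ χ′)
  sig-∨ (sig p n) (sig p′ n′) = sig (⊆-++ p p′) (⊆-++ n n′)

  sig-□ : ∀ {χ} → InSig Pos Neg χ → InSig Pos Neg (□ χ)
  sig-□ (sig p n) = sig p n

  sig-◇ : ∀ {χ} → InSig Pos Neg χ → InSig Pos Neg (◇ χ)
  sig-◇ (sig p n) = sig p n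

  sig-⋁ : ∀ {A : Set} {F : A → Fm} xs → (∀ {x} → x ∈ xs → InSig Pos Neg (F x)) → InSig Pos Neg (⋁ xs F)
  sig-⋁ []       s = sig (λ ()) λ ()
  sig-⋁ (x ∷ xs) s = sig-∨ (s (here refl)) (sig-⋁ xs (s ∘ there))

  sig-⋀ : ∀ {A : Set} {F : A → Fm} xs → (∀ {x} → x ∈ xs → InSig Pos Neg (F x)) → InSig Pos Neg (⋀ xs F)
  sig-⋀ []       s = sig-⊤
  sig-⋀ (x ∷ xs) s = sig-∧ (s (here refl)) (sig-⋀ xs (s ∘ there))

module _ {K : Set} (_≟ₖ_ : DecidableEquality K) where

  _[_≔_] : (K → Bool) → K → Bool → (K → Bool)
  (f [ k ≔ b ]) k′ = if does (k′ ≟ₖ k) then b else f k′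

  assignments : List K → List (K → Bool)
  assignments []       = [ const false ]
  assignments (k ∷ ks) = cartesianProductWith (λ f b → f [ k ≔ b ]) (assignments ks) (true ∷ false ∷ [])

  assignments-complete : ∀ ks (g : K → Bool) → ∃[ f ] f ∈ assignments ks × (∀ {k} → k ∈ ks → f k ≡ g k)
  assignments-complete []       g = const false , here refl , λ ()
  assignments-complete (k ∷ ks) g with assignments-complete ks g
  ... | f , f∈ , f≈g = f [ k ≔ g k ] , ∈-cartesianProductWith⁺ _ f∈ (bool∈ (g k)) , agree
    where
    bool∈ : ∀ b → b ∈ true ∷ false ∷ []
    bool∈ true  = here refl
    bool∈ false = there (here refl)

    agree : ∀ {k′} → k′ ∈ k ∷ ks → (f [ k ≔ g k ]) k′ ≡ g k′
    agree {k′} k′∈ with k′ ≟ₖ k | k′∈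
    ... | yes refl | _          = refl
    ... | no k′≢k  | here k′≡k  = ⊥-elim (k′≢k k′≡k)
    ... | no _     | there k′∈′ = f≈g k′∈′

valuations : List ℕ → List Valuation
valuations qs = map Product.curry (assignments (≡-dec _≟ℕ_ _≟_) (cartesianProduct qs allW))

valuations-complete : ∀ qs V → ∃[ V′ ] V′ ∈ valuations qs × Agree qs V′ V
valuations-complete qs V
  with assignments-complete (≡-dec _≟ℕ_ _≟_) (cartesianProduct qs allW) (Product.uncurry V)
... | f , f∈ , f≈V = Product.curry f , ∈-map⁺ Product.curry f∈ , λ q∈ y → f≈V (∈-cartesianProduct⁺ q∈ (∈-allW y))

_∖_ : List ℕ → List ℕ → List ℕ
qs ∖ P = filter (_∉? P) qs

∈-∖⁺ : ∀ {q qs P} → q ∈ qs → q ∉ P → q ∈ qs ∖ P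
∈-∖⁺ {P = P} = ∈-filter⁺ (_∉? P)

∈-∖⁻ : ∀ {q qs P} → q ∈ qs ∖ P → q ∈ qs × q ∉ P
∈-∖⁻ {qs = qs} {P} = ∈-filter⁻ (_∉? P) {xs = qs}

∖-⊆ : ∀ {qs P} → qs ∖ P ⊆ qs
∖-⊆ = proj₁ ∘ ∈-∖⁻

lyndon-transfer : ∀ {φ ψ} P⁺ P⁻ {V₁ V₂} → ⊢Γ (φ ⇒ ψ)
                → (∀ p → p ∈ v⁺ ψ → p ∉ P⁺) → (∀ p → p ∈ v⁻ ψ → p ∉ P⁻)
                → V₁ ≤⟨ v⁺ φ ∖ P⁺ ⟩ V₂ → V₂ ≤⟨ v⁻ φ ∖ P⁻ ⟩ V₁
                → ∀ {w} → V₁ , w ⊨ φ → V₂ , w ⊨ ψ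
lyndon-transfer {φ} {ψ} P⁺ P⁻ {V₁} {V₂} φ⇒ψ ψ⁺ ψ⁻ pos neg {w} =
  ⊨-monotone ψ mix≤V₂ V₂≤mix ∘ φ⇒ψ mix w ∘ ⊨-monotone φ V₁≤mix mix≤V₁
  where
  mix : Valuation
  mix q y with q ∈? P⁺ | q ∈? P⁻
  ... | yes _ | yes _ = V₁ q y
  ... | yes _ | no _  = V₁ q y Bool.∨ V₂ q y
  ... | no _  | yes _ = V₁ q y Bool.∧ V₂ q y
  ... | no _  | no _  = V₂ q y

  ∨-introˡ : ∀ {a b} → a ≡ true → a Bool.∨ b ≡ true
  ∨-introˡ refl = refl

  ∨-introʳ : ∀ {a b} → b ≡ true → a Bool.∨ b ≡ true
  ∨-introʳ {true}  _ = refl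
  ∨-introʳ {false} e = e

  ∨-absorb : ∀ {a b} → (b ≡ true → a ≡ true) → a Bool.∨ b ≡ true → a ≡ true
  ∨-absorb {true}  _ _ = refl
  ∨-absorb {false} h e = h e

  ∧-intro : ∀ {a b} → a ≡ true → b ≡ true → a Bool.∧ b ≡ true
  ∧-intro refl e = e

  V₁≤mix : V₁ ≤⟨ v⁺ φ ⟩ mix
  V₁≤mix {q} q∈ y e with q ∈? P⁺ | q ∈? P⁻
  ... | yes _   | yes _ = e
  ... | yes _   | no _  = ∨-introˡ e
  ... | no q∉P⁺ | yes _ = ∧-intro e (pos (∈-∖⁺ q∈ q∉P⁺) y e)
  ... | no q∉P⁺ | no _  = pos (∈-∖⁺ q∈ q∉P⁺) y e

  mix≤V₁ : mix ≤⟨ v⁻ φ ⟩ V₁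
  mix≤V₁ {q} q∈ y e with q ∈? P⁺ | q ∈? P⁻
  ... | yes _ | yes _   = e
  ... | yes _ | no q∉P⁻ = ∨-absorb (neg (∈-∖⁺ q∈ q∉P⁻) y) e
  ... | no _  | yes _   = ∧-conicalˡ _ _ e
  ... | no _  | no q∉P⁻ = neg (∈-∖⁺ q∈ q∉P⁻) y e

  mix≤V₂ : mix ≤⟨ v⁺ ψ ⟩ V₂
  mix≤V₂ {q} q∈ y e with q ∈? P⁺ | q ∈? P⁻
  ... | yes q∈P⁺ | _     = ⊥-elim (ψ⁺ q q∈ q∈P⁺)
  ... | no _     | yes _ = ∧-conicalʳ _ _ e
  ... | no _     | no _  = e

  V₂≤mix : V₂ ≤⟨ v⁻ ψ ⟩ mix
  V₂≤mix {q} q∈ y e with q ∈? P⁺ | q ∈? P⁻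
  ... | _     | yes q∈P⁻ = ⊥-elim (ψ⁻ q q∈ q∈P⁻)
  ... | yes _ | no _     = ∨-introʳ e
  ... | no _  | no _     = e

-- Hall's theorem for a 2 × 2 bipartite graph.
matching₂ : ∀ {A₁ B₁ A₂ B₂ : Set} → A₁ ⊎ B₁ → A₂ ⊎ B₂ → A₁ ⊎ A₂ → B₁ ⊎ B₂ → (A₁ × B₂) ⊎ (B₁ × A₂)
matching₂ (inj₁ α₁) (inj₂ β₂) _         _         = inj₁ (α₁ , β₂)
matching₂ (inj₂ β₁) (inj₁ α₂) _         _         = inj₂ (β₁ , α₂)
matching₂ (inj₁ α₁) (inj₁ α₂) _         (inj₁ β₁) = inj₂ (β₁ , α₂)
matching₂ (inj₁ α₁) (inj₁ α₂) _         (inj₂ β₂) = inj₁ (α₁ , β₂)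
matching₂ (inj₂ β₁) (inj₂ β₂) (inj₁ α₁) _         = inj₁ (α₁ , β₂)
matching₂ (inj₂ β₁) (inj₂ β₂) (inj₂ α₂) _         = inj₂ (β₁ , α₂)

module Characteristic (Pos Neg : List ℕ) (V* : Valuation) where

  true? : ∀ y q → Dec (V* q y ≡ true)
  true? y q = V* q y Bool.≟ true

  false? : ∀ y q → Dec (V* q y ≡ false)
  false? y q = V* q y Bool.≟ false

  literals : W → Fm
  literals y = ⋀ (filter (true? y) Pos) var ∧ ⋀ (filter (false? y) Neg) (¬' ∘ var)

  cluster : W → Fm
  cluster c = □ (literals c ∨ literals (partner c)) ∧ (□ (◇ (literals c)) ∧ □ (◇ (literals (partner c))))

  characteristic : W → Fm
  characteristic r = literals r ∧ (◇ (cluster a₀) ∧ (◇ (cluster a₁) ∧ □ (◇ (cluster a₀) ∨ ◇ (cluster a₁))))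
  characteristic c = literals c ∧ cluster c

  sig-literals : ∀ y → InSig Pos Neg (literals y)
  sig-literals y = sig-∧ (sig-⋀ _ (sig-var ∘ proj₁ ∘ ∈-filter⁻ (true? y) {xs = Pos}))
                         (sig-⋀ _ (sig-¬var ∘ proj₁ ∘ ∈-filter⁻ (false? y) {xs = Neg}))

  sig-cluster : ∀ c → InSig Pos Neg (cluster c)
  sig-cluster c = sig-∧ (sig-□ (sig-∨ (sig-literals c) (sig-literals (partner c))))
                        (sig-∧ (sig-□ (sig-◇ (sig-literals c))) (sig-□ (sig-◇ (sig-literals (partner c)))))

  sig-characteristic : ∀ u → InSig Pos Neg (characteristic u)
  sig-characteristic r  = sig-∧ (sig-literals r) (sig-∧ (sig-◇ (sig-cluster a₀)) (sig-∧ (sig-◇ (sig-cluster a₁))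
                                (sig-□ (sig-∨ (sig-◇ (sig-cluster a₀)) (sig-◇ (sig-cluster a₁))))))
  sig-characteristic a₀ = sig-∧ (sig-literals a₀) (sig-cluster a₀)
  sig-characteristic b₀ = sig-∧ (sig-literals b₀) (sig-cluster b₀)
  sig-characteristic a₁ = sig-∧ (sig-literals a₁) (sig-cluster a₁)
  sig-characteristic b₁ = sig-∧ (sig-literals b₁) (sig-cluster b₁)

  literals-self : ∀ y → V* , y ⊨ literals y
  literals-self y = ⋀-intro _ (proj₂ ∘ ∈-filter⁻ (true? y) {xs = Pos})
                  , ⋀-intro _ (not-¬ ∘ proj₂ ∘ ∈-filter⁻ (false? y) {xs = Neg})

  literals-sound : ∀ {V z y} → V , z ⊨ literals y
                 → (∀ {q} → q ∈ Pos → V* q y ≡ true → V q z ≡ true)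
                 × (∀ {q} → q ∈ Neg → V q z ≡ true → V* q y ≡ true)
  literals-sound {y = y} (pos , neg) =
    (λ q∈ t → ⋀-elim pos (∈-filter⁺ (true? y) q∈ t)) ,
    (λ {q} q∈ t → decidable-stable (true? y q) λ f → ⋀-elim neg (∈-filter⁺ (false? y) q∈ (¬-not f)) t)

  cluster-persistent : ∀ c {V z y} → R z y → V , z ⊨ cluster c → V , y ⊨ cluster c
  cluster-persistent c e (covered , sees-c , sees-c̄) = □-up e covered , □-up e sees-c , □-up e sees-c̄

  ◇cluster-final : ∀ c {V u} → u ≢ r → V , u ⊨ ◇ (cluster c) → V , u ⊨ cluster c
  ◇cluster-final c u≢r h =
    let (z , e , cl) = ◇-elim (cluster c) h in cluster-persistent c (final-cluster u≢r e ε) cl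

  cluster-self : ∀ {c} → c ≢ r → V* , c ⊨ cluster c
  cluster-self {c} c≢r =
      (λ z e → [ (λ { refl → inj₁ (literals-self c) }) , (λ { refl → inj₂ (literals-self (partner c)) }) ]′
                 (final-successor c≢r e))
    , (λ z e → ◇-intro (literals c) (final-cluster c≢r e ε) (literals-self c))
    , (λ z e → ◇-intro (literals (partner c)) (final-cluster c≢r e (R-partner c)) (literals-self (partner c)))

  characteristic-self : ∀ u → V* , u ⊨ characteristic u
  characteristic-self r  = literals-self r , sees a₀ (λ ()) (R-root a₀) , sees a₁ (λ ()) (R-root a₁)
                         , λ z _ → Sum.map (sees a₀ λ ()) (sees a₁ λ ()) (sees-a₀-or-a₁ z)
    where
    sees : ∀ c → c ≢ r → ∀ {z} → R z c → V* , z ⊨ ◇ (cluster c)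
    sees c c≢r e = ◇-intro (cluster c) e (cluster-self c≢r)
  characteristic-self a₀ = literals-self a₀ , cluster-self λ ()
  characteristic-self b₀ = literals-self b₀ , cluster-self λ ()
  characteristic-self a₁ = literals-self a₁ , cluster-self λ ()
  characteristic-self b₁ = literals-self b₁ , cluster-self λ ()

  record Labelled (V : Valuation) (y x : W) : Set where
    constructor labelled
    field
      at-point   : V , y ⊨ literals x
      at-partner : V , partner y ⊨ literals (partner x)

  Match : Valuation → W → W → Set
  Match V u c = ∃[ x ] R c x × Labelled V u x

  cluster⇒Match : ∀ {V u} c → u ≢ r → V , u ⊨ cluster c → Match V u c
  cluster⇒Match {V} {u} c u≢r (covered , sees-c , sees-c̄)
    with matching₂ (covered u ε) (covered (partner u) (R-partner u))
                   (◇-locate (literals c) u≢r (sees-c u ε)) (◇-locate (literals (partner c)) u≢r (sees-c̄ u ε))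
  ... | inj₁ (ℓc , ℓc̄) = c , ε , labelled ℓc ℓc̄
  ... | inj₂ (ℓc̄ , ℓc) = partner c , R-partner c
                        , labelled ℓc̄ (subst (λ x → V , partner u ⊨ literals x) (sym (partner-involutive c)) ℓc)

  -- Two p-morphisms out of the frame itself stand in for a directed bisimulation
  -- between (V*, u*) and (V, u) that transports the allowed literals.
  record Span (V : Valuation) (u* u : W) : Set where
    field
      k h    : W → W
      k-pm   : IsPMorphism k
      h-pm   : IsPMorphism h
      k-root : k r ≡ u*
      h-root : h r ≡ u
      labels : ∀ y → V , h y ⊨ literals (k y)

  mkSpan : ∀ {V ρ* ρ x₀ x₁ y₀ y₁} → V , ρ ⊨ literals ρ* → Labelled V y₀ x₀ → Labelled V y₁ x₁
         → IsPMorphism (clusterMap ρ* x₀ x₁) → IsPMorphism (clusterMap ρ y₀ y₁) → Span V ρ* ρ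
  mkSpan {ρ* = ρ*} {ρ} {x₀} {x₁} {y₀} {y₁} ℓρ* (labelled ℓ₀ ℓ₀′) (labelled ℓ₁ ℓ₁′) k-pm h-pm = record
    { k = clusterMap ρ* x₀ x₁ ; h = clusterMap ρ y₀ y₁
    ; k-pm = k-pm ; h-pm = h-pm ; k-root = refl ; h-root = refl
    ; labels = λ { r → ℓρ* ; a₀ → ℓ₀ ; b₀ → ℓ₀′ ; a₁ → ℓ₁ ; b₁ → ℓ₁′ } }

  span-final : ∀ {V c u} → c ≢ r → V , u ⊨ (literals c ∧ cluster c) → Span V c u
  span-final {c = c} {u} c≢r (ℓc , cl) with u ≟ r
  ... | yes refl = let (x₀ , e₀ , l₀) = cluster⇒Match c (λ ()) (cluster-persistent c (R-root a₀) cl)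
                       (x₁ , e₁ , l₁) = cluster⇒Match c (λ ()) (cluster-persistent c (R-root a₁) cl)
                   in mkSpan ℓc l₀ l₁ (clusterMap-pm-final c≢r e₀ e₁) (proj₁ (clusterMap-pm-root ε ε))
  ... | no u≢r   = let (x , e , l) = cluster⇒Match c u≢r cl
                   in mkSpan ℓc l l (clusterMap-pm-final c≢r e e) (clusterMap-pm-final u≢r ε ε)

  span-root-final : ∀ {V u} → u ≢ r → V , u ⊨ characteristic r → Span V r u
  span-root-final u≢r (ℓr , ◇cl₀ , ◇cl₁ , _) =
    let (x₀ , e₀ , l₀) = cluster⇒Match a₀ u≢r (◇cluster-final a₀ u≢r ◇cl₀)
        (x₁ , e₁ , l₁) = cluster⇒Match a₁ u≢r (◇cluster-final a₁ u≢r ◇cl₁)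
    in mkSpan ℓr l₀ l₁ (proj₁ (clusterMap-pm-root e₀ e₁)) (clusterMap-pm-final u≢r ε ε)

  span-root-root : ∀ {V} → V , r ⊨ characteristic r → Span V r r
  span-root-root {V} (ℓr , ◇cl₀ , ◇cl₁ , □◇cl) =
    [ aligned , crossed ]′
      (matching₂ (some-cluster a₀ λ ()) (some-cluster a₁ λ ()) (realised a₀ ◇cl₀) (realised a₁ ◇cl₁))
    where
    some-cluster : ∀ u → u ≢ r → V , u ⊨ cluster a₀ ⊎ V , u ⊨ cluster a₁
    some-cluster u u≢r = Sum.map (◇cluster-final a₀ u≢r) (◇cluster-final a₁ u≢r) (□◇cl u (R-root u))

    realised : ∀ c → V , r ⊨ ◇ (cluster c) → V , a₀ ⊨ cluster c ⊎ V , a₁ ⊨ cluster c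
    realised c h = let (z , _ , cl) = ◇-elim (cluster c) h
                   in Sum.map (λ e → cluster-persistent c e cl) (λ e → cluster-persistent c e cl) (sees-a₀-or-a₁ z)

    aligned : V , a₀ ⊨ cluster a₀ × V , a₁ ⊨ cluster a₁ → Span V r r
    aligned (cl₀ , cl₁) =
      let (x₀ , e₀ , l₀) = cluster⇒Match a₀ (λ ()) cl₀
          (x₁ , e₁ , l₁) = cluster⇒Match a₁ (λ ()) cl₁
      in mkSpan ℓr l₀ l₁ (proj₁ (clusterMap-pm-root e₀ e₁)) (proj₁ (clusterMap-pm-root ε ε))

    crossed : V , a₀ ⊨ cluster a₁ × V , a₁ ⊨ cluster a₀ → Span V r r
    crossed (cl₁ , cl₀) =
      let (x₀ , e₀ , l₀) = cluster⇒Match a₁ (λ ()) cl₁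
          (x₁ , e₁ , l₁) = cluster⇒Match a₀ (λ ()) cl₀
      in mkSpan ℓr l₁ l₀ (proj₁ (clusterMap-pm-root e₁ e₀)) (proj₂ (clusterMap-pm-root ε ε))

  characteristic⇒Span : ∀ {V u} u* → V , u ⊨ characteristic u* → Span V u* u
  characteristic⇒Span {u = u} r h with u ≟ r
  ... | yes refl = span-root-root h
  ... | no u≢r   = span-root-final u≢r h
  characteristic⇒Span a₀ = span-final λ ()
  characteristic⇒Span b₀ = span-final λ ()
  characteristic⇒Span a₁ = span-final λ ()
  characteristic⇒Span b₁ = span-final λ ()

module Interpolant (φ : Fm) (P⁺ P⁻ : List ℕ) where
  open Characteristic (v⁺ φ ∖ P⁺) (v⁻ φ ∖ P⁻)

  satisfies? : ∀ m → Dec (proj₁ m , proj₂ m ⊨ φ)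
  satisfies? (V , w) = ⊨? V w φ

  candidates models : List (Valuation × W)
  candidates = cartesianProduct (valuations (v⁺ φ ++ v⁻ φ)) allW
  models     = filter satisfies? candidates

  θ : Fm
  θ = ⋁ models (Product.uncurry characteristic)

  sig-θ : InSig (v⁺ φ ∖ P⁺) (v⁻ φ ∖ P⁻) θ
  sig-θ = sig-⋁ models λ {(V* , u*)} _ → sig-characteristic V* u*

  vars-characteristic⊆vars-φ : ∀ V* u* → v⁺ (characteristic V* u*) ++ v⁻ (characteristic V* u*) ⊆ v⁺ φ ++ v⁻ φ
  vars-characteristic⊆vars-φ V* u* = ++⁺ (∖-⊆ {v⁺ φ} {P⁺} ∘ pos) (∖-⊆ {v⁻ φ} {P⁻} ∘ neg)
    where open InSig (sig-characteristic V* u*)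

  φ⇒θ : ⊢Γ (φ ⇒ θ)
  φ⇒θ V w hφ =
    let (V′ , V′∈ , V′≈V) = valuations-complete (v⁺ φ ++ v⁻ φ) V
        V′⊨φ = ⊨-agree φ (λ q∈ y → sym (V′≈V q∈ y)) hφ
    in ⋁-intro {F = Product.uncurry characteristic}
         (∈-filter⁺ satisfies? (∈-cartesianProduct⁺ V′∈ (∈-allW w)) V′⊨φ)
         (⊨-agree (characteristic V′ w) (V′≈V ∘ vars-characteristic⊆vars-φ V′ w) (characteristic-self V′ w))

  span-transfer : ∀ {V* u* V u ψ} → Span V* V u* u → V* , u* ⊨ φ → ⊢Γ (φ ⇒ ψ)
                → (∀ p → p ∈ v⁺ ψ → p ∉ P⁺) → (∀ p → p ∈ v⁻ ψ → p ∉ P⁻) → V , u ⊨ ψ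
  span-transfer {V*} {u*} {V} {u} {ψ} sp hφ φ⇒ψ ψ⁺ ψ⁻ =
    subst (λ x → V , x ⊨ ψ) h-root
      (pullback⁻ h-pm ψ (lyndon-transfer P⁺ P⁻ φ⇒ψ ψ⁺ ψ⁻ pos neg
        (pullback⁺ k-pm φ (subst (λ x → V* , x ⊨ φ) (sym k-root) hφ))))
    where
    open Span V* sp

    pos : V* ∘ᵥ k ≤⟨ v⁺ φ ∖ P⁺ ⟩ V ∘ᵥ h
    pos q∈ y = proj₁ (literals-sound V* (labels y)) q∈

    neg : V ∘ᵥ h ≤⟨ v⁻ φ ∖ P⁻ ⟩ V* ∘ᵥ k
    neg q∈ y = proj₂ (literals-sound V* (labels y)) q∈

  θ⇒ψ : ∀ ψ → ⊢Γ (φ ⇒ ψ) → (∀ p → p ∈ v⁺ ψ → p ∉ P⁺) → (∀ p → p ∈ v⁻ ψ → p ∉ P⁻) → ⊢Γ (θ ⇒ ψ)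
  θ⇒ψ ψ φ⇒ψ ψ⁺ ψ⁻ V u hθ =
    let ((V* , u*) , m , holds) = ⋁-elim models hθ
        V*⊨φ = proj₂ (∈-filter⁻ satisfies? {xs = candidates} m)
    in span-transfer (characteristic⇒Span V* u* holds) V*⊨φ φ⇒ψ ψ⁺ ψ⁻

theorem7p2 : ULIP
theorem7p2 φ P⁺ P⁻ = θ , φ⇒θ , (λ p → ∈-∖⁻ ∘ pos) , (λ p → ∈-∖⁻ ∘ neg) , θ⇒ψ
  where
  open Interpolant φ P⁺ P⁻
  open InSig sig-θ
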